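{- Let $(R,\mathfrak{m})$ be a finite local Frobenius ring with residue field $\mathbb{F}_2$, and let $e$ be the unique element with $\mathrm{Ann}_R(e)=\mathfrak{m}$. For $a\in R$, \[\sum_{b\sim a} b=\begin{cases} e & \text{if } R/\mathrm{Ann}_R(a)\cong\mathbb{F}_2 \text{ or } R/\mathrm{Ann}_R(a)\cong\mathbb{F}_2[x]/(x^2),\\ 0 & \text{otherwise,}\end{cases}\] where the sum runs over all $b\in R$ associate to $a$.
   Context: All rings are finite, commutative with identity. A finite ring $R$ is Frobenius if for some positive integer $n$ with $nR=0$ there is a $\mathbb{Z}/n$-linear map $\psi\colon R\to\mathbb{Z}/n$ whose kernel contains no nonzero ideal. Elements $b,a\in R$ are associates, written $b\sim a$, if $b=ua$ for some $u\in R^\times$. -}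

module Defs where

open import Level using (Level; _⊔_; 0ℓ)
open import Data.Bool using (Bool; true; false; _∧_; _xor_)
open import Data.Product using (Σ; ∃; _×_; _,_; proj₁; proj₂)
open import Data.Sum using (_⊎_)
open import Data.Nat using (ℕ; zero; suc) renaming (_+_ to _+ℕ_; _*_ to _*ℕ_)
open import Data.Nat.DivMod using (_mod_)
open import Data.Fin using (Fin; toℕ)
open import Data.List using (List; []; _∷_; filter; foldr)
open import Data.List.Relation.Unary.Any as Any using (Any; any?)
open import Data.List.Relation.Unary.AllPairs using (AllPairs)
open import Relation.Nullary using (¬_; Dec; yes; no)
open import Relation.Nullary.Decidable as Dec using ()
open import Relation.Unary using (Pred)
import Relation.Unary as U
open import Relation.Binary using (Decidable)
open import Relation.Binary.PropositionalEquality using (_≡_; refl)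
open import Function using (_⇔_; mk⇔)
open import Algebra.Bundles using (CommutativeRing)
open import Algebra.Bundles.Raw using (RawRing)
import Algebra.Definitions.RawMonoid as RawMonoidDefs

𝔽₂ : RawRing 0ℓ 0ℓ
𝔽₂ = record
  { Carrier = Bool ; _≈_ = _≡_ ; _+_ = _xor_ ; _*_ = _∧_
  ; -_ = λ x → x ; 0# = false ; 1# = true }

-- 𝔽₂[x]/(x²): the pair (a , b) stands for a + b x
𝔽₂[x]/x² : RawRing 0ℓ 0ℓ
𝔽₂[x]/x² = record
  { Carrier = Bool × Bool
  ; _≈_ = _≡_
  ; _+_ = λ { (a , b) (c , d) → (a xor c) , (b xor d) }
  ; _*_ = λ { (a , b) (c , d) → (a ∧ c) , ((a ∧ d) xor (b ∧ c)) }
  ; -_ = λ x → x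
  ; 0# = false , false
  ; 1# = true , false }

module _ {c ℓ} (R : CommutativeRing c ℓ) where
  open CommutativeRing R
  open RawMonoidDefs +-rawMonoid using () renaming (_×_ to _·_)

  IsUnit : Carrier → Set (c ⊔ ℓ)
  IsUnit x = ∃ λ y → x * y ≈ 1#

  NonUnit : Carrier → Set (c ⊔ ℓ)
  NonUnit x = ¬ IsUnit x

  Associate : Carrier → Carrier → Set (c ⊔ ℓ)
  Associate b a = ∃ λ u → IsUnit u × (b ≈ u * a)

  Ann : Carrier → Carrier → Set ℓ
  Ann a x = x * a ≈ 0#

  record IsIdeal {p} (I : Pred Carrier p) : Set (c ⊔ ℓ ⊔ p) where
    field
      resp    : ∀ {x y} → x ≈ y → I x → I y
      has-0   : I 0#
      +-closed : ∀ {x y} → I x → I y → I (x + y)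
      *-closed : ∀ r {x} → I x → I (r * x)

  IsLocal : Set (c ⊔ ℓ)
  IsLocal = (¬ (1# ≈ 0#)) × IsIdeal NonUnit

  record Finite : Set (c ⊔ ℓ) where
    field
      _≈?_     : Decidable _≈_
      elems    : List Carrier
      complete : ∀ x → Any (x ≈_) elems
      distinct : AllPairs (λ x y → ¬ (x ≈ y)) elems

  -- Frobenius: for n = suc k with n R = 0 there is a ℤ/n-linear
  -- ψ : R → ℤ/n (ℤ/n represented by Fin n) whose kernel contains no
  -- nonzero ideal.
  record IsFrobenius : Set (Level.suc (c ⊔ ℓ)) where
    field
      k        : ℕ
      nR≈0     : ∀ x → (suc k · x) ≈ 0#
      ψ        : Carrier → Fin (suc k)
      ψ-cong   : ∀ {x y} → x ≈ y → ψ x ≡ ψ y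
      ψ-+      : ∀ x y → ψ (x + y) ≡ (toℕ (ψ x) +ℕ toℕ (ψ y)) mod (suc k)
      ψ-scalar : ∀ (m : ℕ) x → ψ (m · x) ≡ (m *ℕ toℕ (ψ x)) mod (suc k)
      nondeg   : (I : Pred Carrier (c ⊔ ℓ)) → IsIdeal I →
                 (∀ x → I x → toℕ (ψ x) ≡ 0) → ∀ x → I x → x ≈ 0#

  -- R / I ≅ S, rendered (first isomorphism theorem) as: there is a
  -- surjective unital ring homomorphism f : R → S with kernel exactly I.
  QuotientIso : ∀ {p s} (I : Pred Carrier p) (S : RawRing s s) → Set (c ⊔ ℓ ⊔ p ⊔ s)
  QuotientIso I S =
    Σ (Carrier → S.Carrier) λ f →
      (∀ {x y} → x ≈ y → f x S.≈ f y) ×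
      (∀ x y → f (x + y) S.≈ (f x S.+ f y)) ×
      (∀ x y → f (x * y) S.≈ (f x S.* f y)) ×
      (f 1# S.≈ S.1#) ×
      (∀ z → ∃ λ x → f x S.≈ z) ×
      (∀ x → (f x S.≈ S.0#) ⇔ I x)
    where module S = RawRing S

  module _ (F : Finite) where
    open Finite F

    private
      sum : List Carrier → Carrier
      sum = foldr _+_ 0#

    isUnit? : U.Decidable IsUnit
    isUnit? x with any? (λ y → (x * y) ≈? 1#) elems
    ... | yes p = yes (Any.satisfied p)
    ... | no ¬p = no λ { (y , xy≈1) →
          ¬p (Any.map (λ {y'} y≈y' → trans (*-congˡ (sym y≈y')) xy≈1) (complete y)) }

    associate? : (a : Carrier) → U.Decidable (λ b → Associate b a)
    associate? a b with any? (λ u → isUnit? u Dec.×-dec (b ≈? (u * a))) elems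
    ... | yes p = yes (Any.satisfied p)
    ... | no ¬p = no λ { (u , (v , uv≈1) , b≈ua) →
          ¬p (Any.map (λ {u'} u≈u' →
                 (v , trans (*-congʳ (sym u≈u')) uv≈1) ,
                 trans b≈ua (*-congʳ u≈u'))
               (complete u)) }

    sumAssociates : Carrier → Carrier
    sumAssociates a = sum (filter (associate? a) elems)

{-# OPTIONS --safe #-}
-- Since R/𝔪 ≅ 𝔽₂, the units are 1 + 𝔪, so the associates of a form the coset a + 𝔪a. The socle
-- {z | 𝔪z = 0} is {0, e}: ψ cannot vanish on a nonzero socle element z, as Rz = {0, z} is an ideal,
-- yet 2z = 0, so ψ z is the unique element of order two of ℤ/n; hence ψ(z + e) = 0, and z + e,
-- lying in the socle, is 0.
-- If 2a ≠ 0 the associates cancel in pairs b, -b. If 2a = 0 and x ∈ 𝔪a is nonzero, translation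
-- by x pairs them off, so their sum is ⌊N/2⌋·x with N the number of associates; when 𝔪a has two
-- distinct nonzero elements x, y, this holds for x, y and x + y alike, so the sum s satisfies
-- s + s = s, i.e. s = 0. Otherwise 𝔪a is {0} or {0, x}, the associates are {a} or {a, a + x}, the
-- sum is the nonzero socle element a or x, that is e, and r ↦ r·a identifies R/Ann(a) with 𝔽₂ or
-- with 𝔽₂[x]/(x²). Conversely, either isomorphism forces a ≠ 0, 2a = 0 and |𝔪a| ≤ 2.
module Submission where

open import Level using (_⊔_)
open import Data.Bool as Bool using (Bool; true; false; _∧_; _xor_)
open import Data.Bool.Properties using (xor-same; ¬-not)
open import Data.Empty using (⊥-elim)
open import Data.Fin using (toℕ)
open import Data.Fin.Properties using (toℕ-fromℕ<; toℕ<n)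
open import Data.List using (List; []; _∷_; _++_; foldr; length; filter)
open import Data.List.Relation.Unary.All using ([]; _∷_)
open import Data.List.Relation.Unary.AllPairs as AllPairs using ([]; _∷_)
open import Data.List.Relation.Unary.Any as Any using (Any; here; there; any?)
open import Data.Nat using (ℕ; zero; suc; NonZero; _<_; _≤_; s≤s; _%_; ⌊_/2⌋)
  renaming (_+_ to _+ℕ_; _*_ to _*ℕ_)
import Data.Nat.Properties as ℕ
open import Data.Nat.Divisibility using (divides; m%n≡0⇒n∣m)
open import Data.Nat.DivMod using (n%n≡0)
open import Data.Product using (∃; _×_; _,_; proj₁; proj₂)
open import Data.Sum using (_⊎_; inj₁; inj₂; [_,_])
open import Function using (_∘_; _⇔_; mk⇔; Equivalence)
open import Relation.Binary.PropositionalEquality as ≡ using (_≡_; _≢_)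
open import Relation.Nullary using (¬_; Dec; yes; no; contradiction)
open import Relation.Nullary.Decidable using (decidable-stable; _×-dec_; ¬?)
open import Relation.Unary using (Pred)
open import Algebra.Bundles using (CommutativeMonoid; Ring; CommutativeRing)
open import Algebra.Bundles.Raw using (RawRing)
open import Defs

open Equivalence using (to; from)

v+v≡n : ∀ {v n} .{{_ : NonZero n}} → v < n → v ≢ 0 → (v +ℕ v) % n ≡ 0 → v +ℕ v ≡ n
v+v≡n {v} {n} v<n v≢0 [v+v]%n≡0 with m%n≡0⇒n∣m (v +ℕ v) n [v+v]%n≡0
... | divides 0 v+v≡0 = ⊥-elim (v≢0 (ℕ.m+n≡0⇒m≡0 v v+v≡0))
... | divides 1 v+v≡n+0 = ≡.trans v+v≡n+0 (ℕ.+-identityʳ n)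
... | divides (suc (suc q)) v+v≡[2+q]n = ⊥-elim (ℕ.<⇒≱ (ℕ.+-mono-< v<n v<n)
        (≡.subst (n +ℕ n ≤_) (≡.sym v+v≡[2+q]n) (ℕ.+-monoʳ-≤ n (ℕ.m≤m+n n (q *ℕ n)))))

[u+v]%n≡0 : ∀ u v {n} .{{_ : NonZero n}} → u +ℕ u ≡ n → v +ℕ v ≡ n → (u +ℕ v) % n ≡ 0
[u+v]%n≡0 u v {n} u+u≡n v+v≡n = begin
  (u +ℕ v) % n  ≡⟨ ≡.cong (λ w → (w +ℕ v) % n) u≡v ⟩
  (v +ℕ v) % n  ≡⟨ ≡.cong (_% n) v+v≡n ⟩
  n % n         ≡⟨ n%n≡0 n ⟩
  0             ∎
  where
  open ≡.≡-Reasoning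
  u≡v : u ≡ v
  u≡v = begin
    u              ≡⟨ ℕ.n≡⌊n+n/2⌋ u ⟩
    ⌊ u +ℕ u /2⌋   ≡⟨ ≡.cong ⌊_/2⌋ (≡.trans u+u≡n (≡.sym v+v≡n)) ⟩
    ⌊ v +ℕ v /2⌋   ≡⟨ ℕ.n≡⌊n+n/2⌋ v ⟨
    v              ∎

xor≡false⇒≡ : ∀ {p q} → p xor q ≡ false → p ≡ q
xor≡false⇒≡ {false} {false} _ = ≡.refl
xor≡false⇒≡ {true}  {true}  _ = ≡.refl
xor≡false⇒≡ {false} {true}  ()
xor≡false⇒≡ {true}  {false} ()

open RawRing 𝔽₂[x]/x² using () renaming (_+_ to _⊕_; _*_ to _⊗_)

⊕-self : ∀ u → u ⊕ u ≡ (false , false)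
⊕-self (p , q) = ≡.cong₂ _,_ (xor-same p) (xor-same q)

⊕≡0⇒≡ : ∀ u v → u ⊕ v ≡ (false , false) → u ≡ v
⊕≡0⇒≡ (p , q) (p′ , q′) u+v≡0 =
  ≡.cong₂ _,_ (xor≡false⇒≡ (≡.cong proj₁ u+v≡0)) (xor≡false⇒≡ (≡.cong proj₂ u+v≡0))

1+qx-square : ∀ q → (true , q) ⊗ (true , q) ≡ (true , false)
1+qx-square false = ≡.refl
1+qx-square true  = ≡.refl

module UniqueSum {c ℓ} (M : CommutativeMonoid c ℓ) where
  open CommutativeMonoid M
  open import Algebra.Properties.Monoid.Mult monoid public using () renaming (_×_ to _×ₙ_)
  open import Data.List.Membership.Setoid setoid using (_∈_; _∉_)
  open import Data.List.Membership.Setoid.Properties using (∈-∃++; ∈-resp-≈; All[≉]⇒∉)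
  open import Data.List.Relation.Binary.Subset.Setoid setoid using (_⊆_)
  open import Data.List.Relation.Unary.Unique.Setoid setoid using (Unique)
  open import Data.List.Relation.Binary.Permutation.Setoid setoid
    using (_↭_; ↭-refl; ↭-sym; ↭-trans; ↭-prep; ↭-reflexive-≋)
  open import Data.List.Relation.Binary.Permutation.Setoid.Properties setoid
    using (shift; ∈-resp-↭; Unique-resp-↭; xs↭ys⇒|xs|≡|ys|; foldr-commMonoid)
  open import Relation.Binary.Reasoning.Setoid setoid

  sum : List Carrier → Carrier
  sum = foldr _∙_ ε

  sum-↭ : ∀ {xs ys} → xs ↭ ys → sum xs ≈ sum ys
  sum-↭ = foldr-commMonoid isCommutativeMonoid

  ×ₙ-zeroʳ : ∀ n → n ×ₙ ε ≈ ε
  ×ₙ-zeroʳ zero    = refl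
  ×ₙ-zeroʳ (suc n) = trans (identityˡ (n ×ₙ ε)) (×ₙ-zeroʳ n)

  ∈∉⇒≉ : ∀ {x y xs} → x ∈ xs → y ∉ xs → ¬ x ≈ y
  ∈∉⇒≉ x∈xs y∉xs x≈y = y∉xs (∈-resp-≈ setoid x≈y x∈xs)

  ∈-∷⁻ : ∀ {x y xs} → x ∈ y ∷ xs → ¬ x ≈ y → x ∈ xs
  ∈-∷⁻ (here x≈y)  x≉y = contradiction x≈y x≉y
  ∈-∷⁻ (there x∈xs) _  = x∈xs

  ∈-unique⇒↭∷ : ∀ {v xs} → Unique xs → v ∈ xs → ∃ λ ys → xs ↭ v ∷ ys × v ∉ ys × Unique ys
  ∈-unique⇒↭∷ xs-unique v∈xs =
    let (ys , zs , _ , v≈w , xs≋) = ∈-∃++ setoid v∈xs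
        xs↭ = ↭-trans (↭-reflexive-≋ xs≋) (shift (sym v≈w) ys zs)
        v∷ys-unique = Unique-resp-↭ xs↭ xs-unique
    in ys ++ zs , xs↭ , All[≉]⇒∉ setoid (AllPairs.head v∷ys-unique) , AllPairs.tail v∷ys-unique

  ⊆⊇⇒↭ : ∀ {xs ys} → Unique xs → Unique ys → xs ⊆ ys → ys ⊆ xs → xs ↭ ys
  ⊆⊇⇒↭ {[]}    {[]}    _ _ _ _ = ↭-refl
  ⊆⊇⇒↭ {[]}    {_ ∷ _} _ _ _ ys⊆[] with () ← ys⊆[] (here refl)
  ⊆⊇⇒↭ {x ∷ xs} (x≉xs ∷ xs-unique) ys-unique xs⊆ys ys⊆xs
    with ys′ , ys↭ , x∉ys′ , ys′-unique ← ∈-unique⇒↭∷ ys-unique (xs⊆ys (here refl))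
    = ↭-trans (↭-prep x (⊆⊇⇒↭ xs-unique ys′-unique
        (λ z∈xs → ∈-∷⁻ (∈-resp-↭ ys↭ (xs⊆ys (there z∈xs))) (∈∉⇒≉ z∈xs x∉xs))
        (λ z∈ys′ → ∈-∷⁻ (ys⊆xs (∈-resp-↭ (↭-sym ys↭) (there z∈ys′))) (∈∉⇒≉ z∈ys′ x∉ys′))))
      (↭-sym ys↭)
    where
    x∉xs : x ∉ xs
    x∉xs = All[≉]⇒∉ setoid x≉xs

  module _ (σ : Carrier → Carrier) (σ-cong : ∀ {x y} → x ≈ y → σ x ≈ σ y)
           (σ-involutive : ∀ x → σ (σ x) ≈ x) where

    σ-closed-without-pair : ∀ {x xs ys} → x ∉ xs → xs ↭ σ x ∷ ys → σ x ∉ ys →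
                            (∀ {z} → z ∈ x ∷ xs → σ z ∈ x ∷ xs) → ∀ {z} → z ∈ ys → σ z ∈ ys
    σ-closed-without-pair {x} {xs} x∉xs xs↭ σx∉ys closed {z} z∈ys =
      ∈-∷⁻ (∈-resp-↭ xs↭ (∈-∷⁻ (closed (there z∈xs)) σz≉x)) σz≉σx
      where
      z∈xs : z ∈ xs
      z∈xs = ∈-resp-↭ (↭-sym xs↭) (there z∈ys)
      σz≉x : ¬ σ z ≈ x
      σz≉x σz≈x = ∈∉⇒≉ z∈ys σx∉ys (trans (sym (σ-involutive z)) (σ-cong σz≈x))
      σz≉σx : ¬ σ z ≈ σ x
      σz≉σx σz≈σx = ∈∉⇒≉ z∈xs x∉xs
        (trans (sym (σ-involutive z)) (trans (σ-cong σz≈σx) (σ-involutive x)))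

    sum-involution : ∀ {s xs} → Unique xs →
                     (∀ {z} → z ∈ xs → σ z ∈ xs) → (∀ {z} → z ∈ xs → ¬ σ z ≈ z) →
                     (∀ {z} → z ∈ xs → z ∙ σ z ≈ s) →
                     sum xs ≈ ⌊ length xs /2⌋ ×ₙ s
    sum-involution = go _ ℕ.≤-refl
      where
      go : ∀ n {s xs} → length xs ≤ n → Unique xs →
           (∀ {z} → z ∈ xs → σ z ∈ xs) → (∀ {z} → z ∈ xs → ¬ σ z ≈ z) →
           (∀ {z} → z ∈ xs → z ∙ σ z ≈ s) →
           sum xs ≈ ⌊ length xs /2⌋ ×ₙ s
      go _       {xs = []} _ _ _ _ _ = refl
      go (suc n) {s} {x ∷ xs} (s≤s |xs|≤n) (x≉xs ∷ xs-unique) closed free pairs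
        with ys , xs↭ , σx∉ys , ys-unique ←
             ∈-unique⇒↭∷ xs-unique (∈-∷⁻ (closed (here refl)) (free (here refl)))
        = let |xs|≡1+|ys| = xs↭ys⇒|xs|≡|ys| xs↭
              ys⊆x∷xs = λ {z} (z∈ys : z ∈ ys) → there (∈-resp-↭ (↭-sym xs↭) (there z∈ys))
              sum-ys = go n (ℕ.<⇒≤ (≡.subst (_≤ n) |xs|≡1+|ys| |xs|≤n)) ys-unique
                         (σ-closed-without-pair (All[≉]⇒∉ setoid x≉xs) xs↭ σx∉ys closed)
                         (free ∘ ys⊆x∷xs) (pairs ∘ ys⊆x∷xs)
          in begin
          x ∙ sum xs                         ≈⟨ ∙-congˡ (sum-↭ xs↭) ⟩
          x ∙ (σ x ∙ sum ys)                 ≈⟨ assoc x (σ x) (sum ys) ⟨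
          (x ∙ σ x) ∙ sum ys                 ≈⟨ ∙-cong (pairs (here refl)) sum-ys ⟩
          s ∙ (⌊ length ys /2⌋ ×ₙ s)         ≡⟨ ≡.cong (λ m → ⌊ suc m /2⌋ ×ₙ s) |xs|≡1+|ys| ⟨
          ⌊ length (x ∷ xs) /2⌋ ×ₙ s         ∎

module RingIdentities {c ℓ} (R : Ring c ℓ) where
  open Ring R
  open import Algebra.Properties.Ring R using (+-inverseˡ-unique)
  open import Relation.Binary.Reasoning.Setoid setoid

  x+y≈0⇒x≈y : ∀ {x y} → y + y ≈ 0# → x + y ≈ 0# → x ≈ y
  x+y≈0⇒x≈y {x} {y} y+y≈0 x+y≈0 =
    trans (+-inverseˡ-unique x y x+y≈0) (sym (+-inverseˡ-unique y y y+y≈0))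

  [1+1]*z≈z+z : ∀ z → (1# + 1#) * z ≈ z + z
  [1+1]*z≈z+z z = trans (distribʳ z 1# 1#) (+-cong (*-identityˡ z) (*-identityˡ z))

  z+z≈0⇒r*z+r*z≈0 : ∀ {z} → z + z ≈ 0# → ∀ r → r * z + r * z ≈ 0#
  z+z≈0⇒r*z+r*z≈0 {z} z+z≈0 r = trans (sym (distribˡ r z z)) (trans (*-congˡ z+z≈0) (zeroʳ r))

  u*z≈z+[u-1]*z : ∀ u z → u * z ≈ z + (u + - 1#) * z
  u*z≈z+[u-1]*z u z = sym (begin
    z + (u + - 1#) * z        ≈⟨ +-congˡ (distribʳ z u (- 1#)) ⟩
    z + (u * z + - 1# * z)    ≈⟨ +-congˡ (+-comm (u * z) (- 1# * z)) ⟩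
    z + (- 1# * z + u * z)    ≈⟨ +-assoc z (- 1# * z) (u * z) ⟨
    (z + - 1# * z) + u * z    ≈⟨ +-congʳ (+-congʳ (*-identityˡ z)) ⟨
    (1# * z + - 1# * z) + u * z ≈⟨ +-congʳ (distribʳ z 1# (- 1#)) ⟨
    (1# + - 1#) * z + u * z   ≈⟨ +-congʳ (*-congʳ (-‿inverseʳ 1#)) ⟩
    0# * z + u * z            ≈⟨ +-congʳ (zeroˡ z) ⟩
    0# + u * z                ≈⟨ +-identityˡ (u * z) ⟩
    u * z                     ∎)

module 𝔽₂Action {c ℓ} (R : Ring c ℓ) where
  open Ring R

  infixr 8 _·_
  _·_ : Bool → Carrier → Carrier
  true  · z = z
  false · z = 0#

  ·-congˡ : ∀ p {z z′} → z ≈ z′ → p · z ≈ p · z′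
  ·-congˡ true  z≈z′ = z≈z′
  ·-congˡ false _    = refl

  *-· : ∀ r p z → r * (p · z) ≈ p · (r * z)
  *-· r true  z = refl
  *-· r false z = zeroʳ r

  ·-∧ : ∀ p q z → p · (q · z) ≈ (p ∧ q) · z
  ·-∧ true  q z = refl
  ·-∧ false q z = refl

  ·-distribˡ-+ : ∀ p y z → p · (y + z) ≈ p · y + p · z
  ·-distribˡ-+ true  y z = refl
  ·-distribˡ-+ false y z = sym (+-identityˡ 0#)

  ·-xor : ∀ {z} → z + z ≈ 0# → ∀ p q → p · z + q · z ≈ (p xor q) · z
  ·-xor {z} _     false q     = +-identityˡ (q · z)
  ·-xor {z} _     true  false = +-identityʳ z
  ·-xor     z+z≈0 true  true  = z+z≈0

module IdealsAndQuotients {c ℓ} (R : CommutativeRing c ℓ) where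
  open CommutativeRing R

  ⟨_⟩ : Carrier → Pred Carrier (c ⊔ ℓ)
  ⟨ z ⟩ w = ∃ λ r → w ≈ r * z

  ⟨⟩-isIdeal : ∀ z → IsIdeal R ⟨ z ⟩
  ⟨⟩-isIdeal z = record
    { resp     = λ { x≈y (r , x≈rz) → r , trans (sym x≈y) x≈rz }
    ; has-0    = 0# , sym (zeroˡ z)
    ; +-closed = λ { (r , x≈rz) (r′ , y≈r′z) →
                     r + r′ , trans (+-cong x≈rz y≈r′z) (sym (distribʳ z r r′)) }
    ; *-closed = λ { q (r , x≈rz) → q * r , trans (*-congˡ x≈rz) (sym (*-assoc q r z)) }
    }

  module _ {s p q} {I : Pred Carrier p} {J : Pred Carrier q} (S : RawRing s s) where

    QuotientIso-resp : (∀ x → I x → J x) → (∀ x → J x → I x) → QuotientIso R I S → QuotientIso R J S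
    QuotientIso-resp I⊆J J⊆I (f , f-cong , f-+ , f-* , f-1 , f-onto , f-ker) =
      f , f-cong , f-+ , f-* , f-1 , f-onto , λ x → mk⇔ (I⊆J x ∘ to (f-ker x)) (from (f-ker x) ∘ J⊆I x)

  -- An R-linear bijection S ≅ R·a with 1 ↦ a, R acting on S through coord; it yields R/Ann(a) ≅ S.
  record LinearEmbedding {s} (S : RawRing s s) (a : Carrier) : Set (c ⊔ ℓ ⊔ s) where
    private module S = RawRing S
    field
      ι           : S.Carrier → Carrier
      ι-cong      : ∀ {u v} → u S.≈ v → ι u ≈ ι v
      ι-injective : ∀ {u v} → ι u ≈ ι v → u S.≈ v
      ι-0         : ι S.0# ≈ 0#
      ι-1         : ι S.1# ≈ a
      ι-+         : ∀ u v → ι (u S.+ v) ≈ ι u + ι v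
      ι∈Ra        : ∀ u → ∃ λ r → r * a ≈ ι u
      coord       : Carrier → S.Carrier
      *a≈ι-coord  : ∀ r → r * a ≈ ι (coord r)
      *-ι         : ∀ r u → r * ι u ≈ ι (u S.* coord r)

  quotientIso : ∀ {s} {S : RawRing s s} {a} → LinearEmbedding S a → QuotientIso R (Ann R a) S
  quotientIso {S = S} {a} E = coord , coord-cong , coord-+ , coord-* , coord-1 , coord-onto , coord-ker
    where
    module S = RawRing S
    open LinearEmbedding E
    open import Relation.Binary.Reasoning.Setoid setoid

    coord-cong : ∀ {x y} → x ≈ y → coord x S.≈ coord y
    coord-cong {x} {y} x≈y = ι-injective (begin
      ι (coord x)  ≈⟨ *a≈ι-coord x ⟨
      x * a        ≈⟨ *-congʳ x≈y ⟩
      y * a        ≈⟨ *a≈ι-coord y ⟩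
      ι (coord y)  ∎)

    coord-+ : ∀ x y → coord (x + y) S.≈ (coord x S.+ coord y)
    coord-+ x y = ι-injective (begin
      ι (coord (x + y))          ≈⟨ *a≈ι-coord (x + y) ⟨
      (x + y) * a                ≈⟨ distribʳ a x y ⟩
      x * a + y * a              ≈⟨ +-cong (*a≈ι-coord x) (*a≈ι-coord y) ⟩
      ι (coord x) + ι (coord y)  ≈⟨ ι-+ (coord x) (coord y) ⟨
      ι (coord x S.+ coord y)    ∎)

    coord-* : ∀ x y → coord (x * y) S.≈ (coord x S.* coord y)
    coord-* x y = ι-injective (begin
      ι (coord (x * y))        ≈⟨ *a≈ι-coord (x * y) ⟨
      (x * y) * a              ≈⟨ *-congʳ (*-comm x y) ⟩
      (y * x) * a              ≈⟨ *-assoc y x a ⟩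
      y * (x * a)              ≈⟨ *-congˡ (*a≈ι-coord x) ⟩
      y * ι (coord x)          ≈⟨ *-ι y (coord x) ⟩
      ι (coord x S.* coord y)  ∎)

    coord-1 : coord 1# S.≈ S.1#
    coord-1 = ι-injective (trans (sym (*a≈ι-coord 1#)) (trans (*-identityˡ a) (sym ι-1)))

    coord-onto : ∀ u → ∃ λ r → coord r S.≈ u
    coord-onto u = let (r , r*a≈ιu) = ι∈Ra u in r , ι-injective (trans (sym (*a≈ι-coord r)) r*a≈ιu)

    coord-ker : ∀ r → (coord r S.≈ S.0#) ⇔ Ann R a r
    coord-ker r = mk⇔
      (λ coord≈0 → trans (*a≈ι-coord r) (trans (ι-cong coord≈0) ι-0))
      (λ r*a≈0 → ι-injective (trans (sym (*a≈ι-coord r)) (trans r*a≈0 (sym ι-0))))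

module ResidueField {c ℓ} (R : CommutativeRing c ℓ) (F : Finite R)
                    (R/𝔪≅𝔽₂ : QuotientIso R (NonUnit R) 𝔽₂) where
  open CommutativeRing R
  open Finite F
  open import Algebra.Properties.Ring ring using (-‿distribˡ-*; -‿involutive; +-identityʳ-unique; x+x≈x⇒x≈0)
  open import Algebra.Properties.CommutativeSemigroup +-commutativeSemigroup using (interchange)
  open import Algebra.Properties.CommutativeSemigroup *-commutativeSemigroup using (x∙yz≈y∙xz)
  open import Algebra.Properties.CommutativeMonoid.Mult +-commutativeMonoid using (×-congʳ; ×-distrib-+)
  open import Data.List.Membership.Setoid setoid using (_∈_; _∉_)
  open import Data.List.Membership.Setoid.Properties using (∈-filter⁺; ∈-filter⁻; ∈-resp-≈)
  open import Data.List.Relation.Unary.Unique.Setoid setoid using (Unique)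
  import Data.List.Relation.Unary.Unique.Setoid.Properties as Unique
  open import Relation.Binary.Reasoning.Setoid setoid
  open RingIdentities ring
  open 𝔽₂Action ring
  open UniqueSum +-commutativeMonoid
  open IdealsAndQuotients R

  res : Carrier → Bool
  res = proj₁ R/𝔪≅𝔽₂

  res-cong : ∀ {x y} → x ≈ y → res x ≡ res y
  res-cong = let (_ , cong , _) = R/𝔪≅𝔽₂ in cong

  res-+ : ∀ x y → res (x + y) ≡ res x xor res y
  res-+ = let (_ , _ , +-hom , _) = R/𝔪≅𝔽₂ in +-hom

  res-* : ∀ x y → res (x * y) ≡ res x ∧ res y
  res-* = let (_ , _ , _ , *-hom , _) = R/𝔪≅𝔽₂ in *-hom

  res-1 : res 1# ≡ true
  res-1 = let (_ , _ , _ , _ , 1-hom , _) = R/𝔪≅𝔽₂ in 1-hom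

  res-ker : ∀ x → (res x ≡ false) ⇔ NonUnit R x
  res-ker = let (_ , _ , _ , _ , _ , _ , ker) = R/𝔪≅𝔽₂ in ker

  res-0 : res 0# ≡ false
  res-0 = ≡.trans (res-cong (sym (+-identityˡ 0#))) (≡.trans (res-+ 0# 0#) (xor-same (res 0#)))

  res-‿ : ∀ x → res (- x) ≡ res x
  res-‿ x = ≡.sym (xor≡false⇒≡
    (≡.trans (≡.sym (res-+ x (- x))) (≡.trans (res-cong (-‿inverseʳ x)) res-0)))

  res-2 : res (1# + 1#) ≡ false
  res-2 = ≡.trans (res-+ 1# 1#) (≡.cong₂ _xor_ res-1 res-1)

  res-1+t : ∀ {t} → res t ≡ false → res (1# + t) ≡ true
  res-1+t {t} res-t = ≡.trans (res-+ 1# t) (≡.cong₂ _xor_ res-1 res-t)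

  res-u-1 : ∀ {u} → res u ≡ true → res (u + - 1#) ≡ false
  res-u-1 {u} res-u = ≡.trans (res-+ u (- 1#)) (≡.cong₂ _xor_ res-u (≡.trans (res-‿ 1#) res-1))

  res≡true⇒unit : ∀ {x} → res x ≡ true → IsUnit R x
  res≡true⇒unit {x} res-x = decidable-stable (isUnit? R F x)
    λ nonunit → contradiction (≡.trans (≡.sym res-x) (from (res-ker x) nonunit)) λ ()

  unit⇒res≡true : ∀ {x} → IsUnit R x → res x ≡ true
  unit⇒res≡true {x} unit = ¬-not λ res-x≡false → to (res-ker x) res-x≡false unit

  unit*z≈0⇒z≈0 : ∀ {u z} → res u ≡ true → u * z ≈ 0# → z ≈ 0#
  unit*z≈0⇒z≈0 {u} {z} res-u uz≈0 = let (v , uv≈1) = res≡true⇒unit res-u in begin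
    z            ≈⟨ *-identityˡ z ⟨
    1# * z       ≈⟨ *-congʳ uv≈1 ⟨
    (u * v) * z  ≈⟨ *-congʳ (*-comm u v) ⟩
    (v * u) * z  ≈⟨ *-assoc v u z ⟩
    v * (u * z)  ≈⟨ *-congˡ uz≈0 ⟩
    v * 0#       ≈⟨ zeroʳ v ⟩
    0#           ∎

  infix 4 _∼_
  _∼_ : Carrier → Carrier → Set (c ⊔ ℓ)
  b ∼ a = ∃ λ u → res u ≡ true × b ≈ u * a

  ∼-reflexive : ∀ {a b} → b ≈ a → b ∼ a
  ∼-reflexive {a} b≈a = 1# , res-1 , trans b≈a (sym (*-identityˡ a))

  associates : Carrier → List Carrier
  associates a = filter (associate? R F a) elems

  ∈-associates⇔∼ : ∀ {a z} → z ∈ associates a ⇔ z ∼ a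
  ∈-associates⇔∼ {a} {z} = mk⇔
    (λ z∈ → let (u , unit , z≈ua) = proj₂ (∈-filter⁻ setoid (associate? R F a) resp {xs = elems} z∈)
            in u , unit⇒res≡true unit , z≈ua)
    (λ (u , res-u , z≈ua) →
       ∈-filter⁺ setoid (associate? R F a) resp (complete z) (u , res≡true⇒unit res-u , z≈ua))
    where
    resp : ∀ {x y} → x ≈ y → Associate R x a → Associate R y a
    resp x≈y (u , unit , x≈ua) = u , unit , trans (sym x≈y) x≈ua

  associates-unique : ∀ a → Unique (associates a)
  associates-unique a = Unique.filter⁺ setoid (associate? R F a) distinct

  sumAssociates≈sum : ∀ {a xs} → Unique xs → (∀ {z} → z ∼ a → z ∈ xs) → (∀ {z} → z ∈ xs → z ∼ a) →
                      sumAssociates R F a ≈ sum xs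
  sumAssociates≈sum {a} xs-unique ∼⇒∈ ∈⇒∼ = sum-↭ (⊆⊇⇒↭ (associates-unique a) xs-unique
    (∼⇒∈ ∘ to ∈-associates⇔∼) (from ∈-associates⇔∼ ∘ ∈⇒∼))

  Socle : Carrier → Set (c ⊔ ℓ)
  Socle z = ∀ r → res r ≡ false → r * z ≈ 0#

  ≈0⇒socle : ∀ {z} → z ≈ 0# → Socle z
  ≈0⇒socle z≈0 r _ = trans (*-congˡ z≈0) (zeroʳ r)

  socle-+ : ∀ {y z} → Socle y → Socle z → Socle (y + z)
  socle-+ {y} {z} y-socle z-socle r res-r =
    trans (distribˡ r y z) (trans (+-cong (y-socle r res-r) (z-socle r res-r)) (+-identityˡ 0#))

  socle-unit : ∀ {z u} → Socle z → res u ≡ true → u * z ≈ z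
  socle-unit {z} {u} z-socle res-u = begin
    u * z               ≈⟨ u*z≈z+[u-1]*z u z ⟩
    z + (u + - 1#) * z  ≈⟨ +-congˡ (z-socle _ (res-u-1 res-u)) ⟩
    z + 0#              ≈⟨ +-identityʳ z ⟩
    z                   ∎

  socle-* : ∀ {z} → Socle z → ∀ r → r * z ≈ res r · z
  socle-* z-socle r with res r in res-r
  ... | true  = socle-unit z-socle res-r
  ... | false = z-socle r res-r

  socle-double : ∀ {z} → Socle z → z + z ≈ 0#
  socle-double {z} z-socle = trans (sym ([1+1]*z≈z+z z)) (z-socle (1# + 1#) res-2)

  infix 4 𝔪·_⊆?_
  𝔪·_⊆?_ : ∀ a ys → (∀ {r} → res r ≡ false → r * a ∈ ys) ⊎ (∃ λ t → res t ≡ false × t * a ∉ ys)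
  𝔪· a ⊆? ys = decide (any? escapes? elems)
    where
    Escapes : Carrier → Set (c ⊔ ℓ)
    Escapes t = res t ≡ false × t * a ∉ ys
    escapes? : ∀ t → Dec (Escapes t)
    escapes? t = (res t Bool.≟ false) ×-dec ¬? (any? ((t * a) ≈?_) ys)
    resp : ∀ {x y} → x ≈ y → Escapes x → Escapes y
    resp x≈y (res-x , xa∉ys) =
      ≡.trans (≡.sym (res-cong x≈y)) res-x , xa∉ys ∘ ∈-resp-≈ setoid (sym (*-congʳ x≈y))
    decide : Dec (Any Escapes elems) → (∀ {r} → res r ≡ false → r * a ∈ ys) ⊎ ∃ Escapes
    decide (yes escape) = inj₂ (Any.satisfied escape)
    decide (no ¬escape) = inj₁ λ {r} res-r → decidable-stable (any? ((r * a) ≈?_) ys)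
      λ ra∉ys → ¬escape (Any.map (λ r≈y → resp r≈y (res-r , ra∉ys)) (complete r))

  sumAssociates-socle : ∀ {a} → Socle a → sumAssociates R F a ≈ a
  sumAssociates-socle {a} a-socle = trans (sumAssociates≈sum ([] ∷ []) ∼⇒∈ ∈⇒∼) (+-identityʳ a)
    where
    ∼⇒∈ : ∀ {z} → z ∼ a → z ∈ a ∷ []
    ∼⇒∈ (u , res-u , z≈ua) = here (trans z≈ua (socle-unit a-socle res-u))
    ∈⇒∼ : ∀ {z} → z ∈ a ∷ [] → z ∼ a
    ∈⇒∼ (here z≈a) = ∼-reflexive z≈a

  sumAssociates-2a≉0 : ∀ {a} → ¬ a + a ≈ 0# → sumAssociates R F a ≈ 0#
  sumAssociates-2a≉0 {a} a+a≉0 = trans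
    (sum-involution -_ -‿cong -‿involutive (associates-unique a) closed free (λ {z} _ → -‿inverseʳ z))
    (×ₙ-zeroʳ ⌊ length (associates a) /2⌋)
    where
    closed : ∀ {z} → z ∈ associates a → - z ∈ associates a
    closed z∈ = let (u , res-u , z≈ua) = to ∈-associates⇔∼ z∈ in
      from ∈-associates⇔∼ (- u , ≡.trans (res-‿ u) res-u , trans (-‿cong z≈ua) (-‿distribˡ-* u a))
    free : ∀ {z} → z ∈ associates a → ¬ - z ≈ z
    free {z} z∈ -z≈z = let (u , res-u , z≈ua) = to ∈-associates⇔∼ z∈ in
      a+a≉0 (unit*z≈0⇒z≈0 res-u (begin
        u * (a + a)    ≈⟨ distribˡ u a a ⟩
        u * a + u * a  ≈⟨ +-cong z≈ua z≈ua ⟨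
        z + z          ≈⟨ +-congʳ -z≈z ⟨
        - z + z        ≈⟨ -‿inverseˡ z ⟩
        0#             ∎))

  module _ {a} (a+a≈0 : a + a ≈ 0#) where

    sumAssociates-translation : ∀ {t} → res t ≡ false → ¬ t * a ≈ 0# →
                                sumAssociates R F a ≈ ⌊ length (associates a) /2⌋ ×ₙ (t * a)
    sumAssociates-translation {t} res-t ta≉0 =
      sum-involution (_+ t * a) +-congʳ involutive (associates-unique a) closed free pairs
      where
      ta+ta≈0 : t * a + t * a ≈ 0#
      ta+ta≈0 = z+z≈0⇒r*z+r*z≈0 a+a≈0 t
      involutive : ∀ z → (z + t * a) + t * a ≈ z
      involutive z = trans (+-assoc z _ _) (trans (+-congˡ ta+ta≈0) (+-identityʳ z))
      closed : ∀ {z} → z ∈ associates a → z + t * a ∈ associates a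
      closed z∈ = let (u , res-u , z≈ua) = to ∈-associates⇔∼ z∈ in
        from ∈-associates⇔∼ (u + t , ≡.trans (res-+ u t) (≡.cong₂ _xor_ res-u res-t) ,
                              trans (+-congʳ z≈ua) (sym (distribʳ a u t)))
      free : ∀ {z} → z ∈ associates a → ¬ z + t * a ≈ z
      free {z} _ z+ta≈z = ta≉0 (+-identityʳ-unique z (t * a) z+ta≈z)
      pairs : ∀ {z} → z ∈ associates a → z + (z + t * a) ≈ t * a
      pairs {z} z∈ = let (u , _ , z≈ua) = to ∈-associates⇔∼ z∈ in begin
        z + (z + t * a)  ≈⟨ +-assoc z z (t * a) ⟨
        (z + z) + t * a  ≈⟨ +-congʳ (trans (+-cong z≈ua z≈ua) (z+z≈0⇒r*z+r*z≈0 a+a≈0 u)) ⟩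
        0# + t * a       ≈⟨ +-identityˡ (t * a) ⟩
        t * a            ∎

    sumAssociates-𝔪a≥3 : ∀ {t t′} → res t ≡ false → res t′ ≡ false →
                         ¬ t * a ≈ 0# → ¬ t′ * a ≈ 0# → ¬ t * a ≈ t′ * a → sumAssociates R F a ≈ 0#
    sumAssociates-𝔪a≥3 {t} {t′} res-t res-t′ ta≉0 t′a≉0 ta≉t′a = x+x≈x⇒x≈0 s (begin
      s + s                      ≈⟨ +-cong (sumAssociates-translation res-t ta≉0)
                                           (sumAssociates-translation res-t′ t′a≉0) ⟩
      n ×ₙ (t * a) + n ×ₙ (t′ * a) ≈⟨ ×-distrib-+ (t * a) (t′ * a) n ⟨
      n ×ₙ (t * a + t′ * a)       ≈⟨ ×-congʳ n (distribʳ a t t′) ⟨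
      n ×ₙ ((t + t′) * a)         ≈⟨ sumAssociates-translation res-t+t′ [t+t′]a≉0 ⟨
      s                           ∎)
      where
      s : Carrier
      s = sumAssociates R F a
      n : ℕ
      n = ⌊ length (associates a) /2⌋
      res-t+t′ : res (t + t′) ≡ false
      res-t+t′ = ≡.trans (res-+ t t′) (≡.cong₂ _xor_ res-t res-t′)
      [t+t′]a≉0 : ¬ (t + t′) * a ≈ 0#
      [t+t′]a≉0 [t+t′]a≈0 = ta≉t′a
        (x+y≈0⇒x≈y (z+z≈0⇒r*z+r*z≈0 a+a≈0 t′) (trans (sym (distribʳ a t t′)) [t+t′]a≈0))

  infix 4 𝔪·_HasAtMostTwoElements
  𝔪·_HasAtMostTwoElements : Carrier → Set (c ⊔ ℓ)
  𝔪· a HasAtMostTwoElements = ∀ {t t′} → res t ≡ false → res t′ ≡ false →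
                              ¬ t * a ≈ 0# → ¬ t′ * a ≈ 0# → t * a ≈ t′ * a

  R/Ann≅𝔽₂⊎𝔽₂[x]/x² : Carrier → Set (c ⊔ ℓ)
  R/Ann≅𝔽₂⊎𝔽₂[x]/x² a = QuotientIso R (Ann R a) 𝔽₂ ⊎ QuotientIso R (Ann R a) 𝔽₂[x]/x²

  𝔽₂-iso⇒socle : ∀ {a} → QuotientIso R (Ann R a) 𝔽₂ → ¬ a ≈ 0# × Socle a
  𝔽₂-iso⇒socle {a} (g , _ , g-+ , _ , g-1 , _ , g-ker) = a≉0 , λ r res-r → to (g-ker r) (g≡false res-r)
    where
    a≉0 : ¬ a ≈ 0#
    a≉0 a≈0 = contradiction (≡.trans (≡.sym g-1) (from (g-ker 1#) (trans (*-identityˡ a) a≈0))) λ ()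
    g≡false : ∀ {r} → res r ≡ false → g r ≡ false
    g≡false {r} res-r with g r in g-r
    ... | false = ≡.refl
    ... | true  = ⊥-elim (a≉0 (unit*z≈0⇒z≈0 (≡.trans (res-+ r 1#) (≡.cong₂ _xor_ res-r res-1))
                    (to (g-ker (r + 1#)) (≡.trans (g-+ r 1#) (≡.cong₂ _xor_ g-r g-1)))))

  𝔽₂[x]/x²-iso⇒ : ∀ {a} → QuotientIso R (Ann R a) 𝔽₂[x]/x² →
                  ¬ a ≈ 0# × a + a ≈ 0# × 𝔪· a HasAtMostTwoElements
  𝔽₂[x]/x²-iso⇒ {a} (g , _ , g-+ , g-* , g-1 , _ , g-ker) = a≉0 , a+a≈0 , 𝔪a≤2
    where
    a≉0 : ¬ a ≈ 0#
    a≉0 a≈0 = contradiction (≡.trans (≡.sym g-1) (from (g-ker 1#) (trans (*-identityˡ a) a≈0))) λ ()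
    a+a≈0 : a + a ≈ 0#
    a+a≈0 = trans (sym ([1+1]*z≈z+z a)) (to (g-ker (1# + 1#)) (≡.trans (g-+ 1# 1#) (≡.cong₂ _⊕_ g-1 g-1)))
    g≡x : ∀ {t} → res t ≡ false → ¬ t * a ≈ 0# → g t ≡ (false , true)
    g≡x {t} res-t ta≉0 with g t in g-t
    ... | false , false = ⊥-elim (ta≉0 (to (g-ker t) g-t))
    ... | false , true  = ≡.refl
    ... | true  , q     = ⊥-elim (a≉0 (unit*z≈0⇒z≈0 res-tt+1 (to (g-ker (t * t + 1#)) g-tt+1)))
      -- g t = 1 + q x is a unit, so g (t² + 1) = (1 + q x)² + 1 = 0 while t² + 1 is a unit of R.
      where
      res-tt+1 : res (t * t + 1#) ≡ true
      res-tt+1 = ≡.trans (res-+ (t * t) 1#)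
        (≡.cong₂ _xor_ (≡.trans (res-* t t) (≡.cong₂ _∧_ res-t res-t)) res-1)
      g-tt+1 : g (t * t + 1#) ≡ (false , false)
      g-tt+1 = ≡.trans (g-+ (t * t) 1#)
        (≡.cong₂ _⊕_ (≡.trans (g-* t t) (≡.trans (≡.cong₂ _⊗_ g-t g-t) (1+qx-square q))) g-1)
    𝔪a≤2 : 𝔪· a HasAtMostTwoElements
    𝔪a≤2 {t} {t′} res-t res-t′ ta≉0 t′a≉0 = x+y≈0⇒x≈y (z+z≈0⇒r*z+r*z≈0 a+a≈0 t′)
      (trans (sym (distribʳ a t t′))
        (to (g-ker (t + t′)) (≡.trans (g-+ t t′) (≡.cong₂ _⊕_ (g≡x res-t ta≉0) (g≡x res-t′ t′a≉0)))))

  R/Ann≅⇒ : ∀ {a} → R/Ann≅𝔽₂⊎𝔽₂[x]/x² a → ¬ a ≈ 0# × a + a ≈ 0# × 𝔪· a HasAtMostTwoElements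
  R/Ann≅⇒ (inj₁ iso) = let (a≉0 , a-socle) = 𝔽₂-iso⇒socle iso in
    a≉0 , socle-double a-socle , λ res-t _ ta≉0 _ → contradiction (a-socle _ res-t) ta≉0
  R/Ann≅⇒ (inj₂ iso) = 𝔽₂[x]/x²-iso⇒ iso

  socle⇒𝔽₂-iso : ∀ {a} → ¬ a ≈ 0# → Socle a → QuotientIso R (Ann R a) 𝔽₂
  socle⇒𝔽₂-iso {a} a≉0 a-socle = QuotientIso-resp 𝔽₂
    (λ r nonunit → a-socle r (from (res-ker r) nonunit))
    (λ r ra≈0 unit → a≉0 (unit*z≈0⇒z≈0 (unit⇒res≡true unit) ra≈0))
    R/𝔪≅𝔽₂

  module 𝔪a-TwoElements {a t : Carrier} (a+a≈0 : a + a ≈ 0#) (res-t : res t ≡ false) (ta≉0 : ¬ t * a ≈ 0#)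
                        (𝔪a⊆ : ∀ {r} → res r ≡ false → r * a ∈ 0# ∷ t * a ∷ []) where

    x : Carrier
    x = t * a

    x+x≈0 : x + x ≈ 0#
    x+x≈0 = z+z≈0⇒r*z+r*z≈0 a+a≈0 t

    [1+t]a≈a+x : (1# + t) * a ≈ a + x
    [1+t]a≈a+x = trans (distribʳ a 1# t) (+-congʳ (*-identityˡ a))

    tx≈0 : t * x ≈ 0#
    tx≈0 with 𝔪a⊆ (≡.trans (res-* t t) (≡.cong₂ _∧_ res-t res-t))
    ... | here tta≈0        = trans (sym (*-assoc t t a)) tta≈0
    ... | there (here tta≈x) = contradiction (unit*z≈0⇒z≈0 (res-1+t res-t) (begin
      (1# + t) * x  ≈⟨ distribʳ x 1# t ⟩
      1# * x + t * x ≈⟨ +-cong (*-identityˡ x) (trans (sym (*-assoc t t a)) tta≈x) ⟩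
      x + x         ≈⟨ x+x≈0 ⟩
      0#            ∎)) ta≉0

    x-socle : Socle x
    x-socle r res-r with 𝔪a⊆ res-r
    ... | here ra≈0        = trans (x∙yz≈y∙xz r t a) (trans (*-congˡ ra≈0) (zeroʳ t))
    ... | there (here ra≈x) = trans (x∙yz≈y∙xz r t a) (trans (*-congˡ ra≈x) tx≈0)

    a≉0 : ¬ a ≈ 0#
    a≉0 a≈0 = ta≉0 (trans (*-congˡ a≈0) (zeroʳ t))

    a≉x : ¬ a ≈ x
    a≉x a≈x = ta≉0 (trans (*-congˡ a≈x) tx≈0)

    ι : Bool × Bool → Carrier
    ι (p , q) = p · a + q · x

    𝔪a-coordinate : ∀ {r} → res r ≡ false → ∃ λ q → r * a ≈ q · x
    𝔪a-coordinate res-r with 𝔪a⊆ res-r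
    ... | here ra≈0        = false , ra≈0
    ... | there (here ra≈x) = true , ra≈x

    coordinates : ∀ r → ∃ λ q → r * a ≈ ι (res r , q)
    coordinates r with res r in res-r
    ... | false = let (q , ra≈qx) = 𝔪a-coordinate res-r in q , trans ra≈qx (sym (+-identityˡ (q · x)))
    ... | true  = let (q , [r-1]a≈qx) = 𝔪a-coordinate (res-u-1 res-r) in
                  q , trans (u*z≈z+[u-1]*z r a) (+-congˡ [r-1]a≈qx)

    coord : Carrier → Bool × Bool
    coord r = res r , proj₁ (coordinates r)

    ι-+ : ∀ u v → ι (u ⊕ v) ≈ ι u + ι v
    ι-+ (p , q) (p′ , q′) = begin
      (p xor p′) · a + (q xor q′) · x      ≈⟨ +-cong (·-xor a+a≈0 p p′) (·-xor x+x≈0 q q′) ⟨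
      (p · a + p′ · a) + (q · x + q′ · x)  ≈⟨ interchange (p · a) (p′ · a) (q · x) (q′ · x) ⟩
      (p · a + q · x) + (p′ · a + q′ · x)  ∎

    ι≈0⇒≡0 : ∀ u → ι u ≈ 0# → u ≡ (false , false)
    ι≈0⇒≡0 (false , false) _      = ≡.refl
    ι≈0⇒≡0 (true  , false) a+0≈0 = contradiction (trans (sym (+-identityʳ a)) a+0≈0) a≉0
    ι≈0⇒≡0 (false , true)  0+x≈0 = contradiction (trans (sym (+-identityˡ x)) 0+x≈0) ta≉0
    ι≈0⇒≡0 (true  , true)  a+x≈0 = contradiction (x+y≈0⇒x≈y x+x≈0 a+x≈0) a≉x

    ι-injective : ∀ {u v} → ι u ≈ ι v → u ≡ v
    ι-injective {u} {v} ιu≈ιv = ⊕≡0⇒≡ u v (ι≈0⇒≡0 (u ⊕ v) (begin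
      ι (u ⊕ v)  ≈⟨ ι-+ u v ⟩
      ι u + ι v  ≈⟨ +-congʳ ιu≈ιv ⟩
      ι v + ι v  ≈⟨ ι-+ v v ⟨
      ι (v ⊕ v)  ≡⟨ ≡.cong ι (⊕-self v) ⟩
      0# + 0#    ≈⟨ +-identityˡ 0# ⟩
      0#         ∎))

    *-ι : ∀ r u → r * ι u ≈ ι (u ⊗ coord r)
    *-ι r (p , q) = let ρ = res r ; (η , ra≈) = coordinates r in begin
      r * (p · a + q · x)                          ≈⟨ distribˡ r (p · a) (q · x) ⟩
      r * (p · a) + r * (q · x)                    ≈⟨ +-cong (*-· r p a) (*-· r q x) ⟩
      p · (r * a) + q · (r * x)                    ≈⟨ +-cong (·-congˡ p ra≈) (·-congˡ q (socle-* x-socle r)) ⟩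
      p · (ρ · a + η · x) + q · (ρ · x)            ≈⟨ +-congʳ (·-distribˡ-+ p (ρ · a) (η · x)) ⟩
      (p · (ρ · a) + p · (η · x)) + q · (ρ · x)    ≈⟨ +-cong (+-cong (·-∧ p ρ a) (·-∧ p η x)) (·-∧ q ρ x) ⟩
      ((p ∧ ρ) · a + (p ∧ η) · x) + (q ∧ ρ) · x    ≈⟨ +-assoc _ _ _ ⟩
      (p ∧ ρ) · a + ((p ∧ η) · x + (q ∧ ρ) · x)    ≈⟨ +-congˡ (·-xor x+x≈0 (p ∧ η) (q ∧ ρ)) ⟩
      (p ∧ ρ) · a + ((p ∧ η) xor (q ∧ ρ)) · x      ∎

    ι∈Ra : ∀ u → ∃ λ r → r * a ≈ ι u
    ι∈Ra (false , false) = 0#     , trans (zeroˡ a) (sym (+-identityˡ 0#))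
    ι∈Ra (true  , false) = 1#     , trans (*-identityˡ a) (sym (+-identityʳ a))
    ι∈Ra (false , true)  = t      , sym (+-identityˡ x)
    ι∈Ra (true  , true)  = 1# + t , [1+t]a≈a+x

    embedding : LinearEmbedding 𝔽₂[x]/x² a
    embedding = record
      { ι           = ι
      ; ι-cong      = λ u≡v → reflexive (≡.cong ι u≡v)
      ; ι-injective = ι-injective
      ; ι-0         = +-identityˡ 0#
      ; ι-1         = +-identityʳ a
      ; ι-+         = ι-+
      ; ι∈Ra        = ι∈Ra
      ; coord       = coord
      ; *a≈ι-coord  = proj₂ ∘ coordinates
      ; *-ι         = *-ι
      }

    quotientIso-𝔽₂[x]/x² : QuotientIso R (Ann R a) 𝔽₂[x]/x²
    quotientIso-𝔽₂[x]/x² = quotientIso embedding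

    sumAssociates≈x : sumAssociates R F a ≈ x
    sumAssociates≈x = trans (sumAssociates≈sum ((a≉a+x ∷ []) ∷ [] ∷ []) ∼⇒∈ ∈⇒∼) (begin
      a + ((a + x) + 0#)  ≈⟨ +-congˡ (+-identityʳ (a + x)) ⟩
      a + (a + x)         ≈⟨ +-assoc a a x ⟨
      (a + a) + x         ≈⟨ +-congʳ a+a≈0 ⟩
      0# + x              ≈⟨ +-identityˡ x ⟩
      x                   ∎)
      where
      a≉a+x : ¬ a ≈ a + x
      a≉a+x a≈a+x = ta≉0 (+-identityʳ-unique a x (sym a≈a+x))
      ∼⇒∈ : ∀ {z} → z ∼ a → z ∈ a ∷ a + x ∷ []
      ∼⇒∈ {z} (u , res-u , z≈ua) =
        let (q , ua≈) = coordinates u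
        in member q (trans z≈ua (trans ua≈ (reflexive (≡.cong (λ p → ι (p , q)) res-u))))
        where
        member : ∀ q → z ≈ a + q · x → z ∈ a ∷ a + x ∷ []
        member false z≈a+0 = here (trans z≈a+0 (+-identityʳ a))
        member true  z≈a+x = there (here z≈a+x)
      ∈⇒∼ : ∀ {z} → z ∈ a ∷ a + x ∷ [] → z ∼ a
      ∈⇒∼ (here z≈a)           = ∼-reflexive z≈a
      ∈⇒∼ (there (here z≈a+x)) = 1# + t , res-1+t res-t , trans z≈a+x (sym [1+t]a≈a+x)

  module Frobenius (FR : IsFrobenius R) (e : Carrier) (Ann-e : ∀ x → Ann R e x ⇔ NonUnit R x) where
    open IsFrobenius FR

    e-socle : Socle e
    e-socle r res-r = from (Ann-e r) (to (res-ker r) res-r)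

    e≉0 : ¬ e ≈ 0#
    e≉0 e≈0 = to (Ann-e 1#) (trans (*-congˡ e≈0) (zeroʳ 1#)) (1# , *-identityˡ 1#)

    toℕ-ψ-+ : ∀ x y → toℕ (ψ (x + y)) ≡ (toℕ (ψ x) +ℕ toℕ (ψ y)) % suc k
    toℕ-ψ-+ x y = ≡.trans (≡.cong toℕ (ψ-+ x y)) (toℕ-fromℕ< _)

    toℕ-ψ-0 : toℕ (ψ 0#) ≡ 0
    toℕ-ψ-0 = ≡.cong toℕ (ψ-scalar 0 0#)

    socle-ψ≡0⇒≈0 : ∀ {z} → Socle z → toℕ (ψ z) ≡ 0 → z ≈ 0#
    socle-ψ≡0⇒≈0 {z} z-socle ψz≡0 = nondeg ⟨ z ⟩ (⟨⟩-isIdeal z) ψ-vanishes z (1# , sym (*-identityˡ z))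
      where
      ψ-vanishes : ∀ w → ⟨ z ⟩ w → toℕ (ψ w) ≡ 0
      ψ-vanishes w (r , w≈rz) with res r | ψ-cong (trans w≈rz (socle-* z-socle r))
      ... | true  | ψw≡ψz = ≡.trans (≡.cong toℕ ψw≡ψz) ψz≡0
      ... | false | ψw≡ψ0 = ≡.trans (≡.cong toℕ ψw≡ψ0) toℕ-ψ-0

    socle-ψ+ψ≡n : ∀ {z} → Socle z → ¬ z ≈ 0# → toℕ (ψ z) +ℕ toℕ (ψ z) ≡ suc k
    socle-ψ+ψ≡n {z} z-socle z≉0 = v+v≡n (toℕ<n (ψ z)) (z≉0 ∘ socle-ψ≡0⇒≈0 z-socle)
      (≡.trans (≡.sym (toℕ-ψ-+ z z)) (≡.trans (≡.cong toℕ (ψ-cong (socle-double z-socle))) toℕ-ψ-0))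

    socle≈e : ∀ {z} → Socle z → ¬ z ≈ 0# → z ≈ e
    socle≈e {z} z-socle z≉0 = x+y≈0⇒x≈y (socle-double e-socle)
      (socle-ψ≡0⇒≈0 (socle-+ z-socle e-socle)
        (≡.trans (toℕ-ψ-+ z e) ([u+v]%n≡0 (toℕ (ψ z)) (toℕ (ψ e))
          (socle-ψ+ψ≡n z-socle z≉0) (socle-ψ+ψ≡n e-socle e≉0))))

    classify : ∀ a → (R/Ann≅𝔽₂⊎𝔽₂[x]/x² a × sumAssociates R F a ≈ e)
                   ⊎ (¬ R/Ann≅𝔽₂⊎𝔽₂[x]/x² a × sumAssociates R F a ≈ 0#)
    classify a with a ≈? 0# | (a + a) ≈? 0# | 𝔪· a ⊆? 0# ∷ []
    ... | yes a≈0 | _ | _ =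
      inj₂ ((λ iso → proj₁ (R/Ann≅⇒ iso) a≈0) , trans (sumAssociates-socle (≈0⇒socle a≈0)) a≈0)
    ... | no _ | no a+a≉0 | _ =
      inj₂ ((λ iso → a+a≉0 (proj₁ (proj₂ (R/Ann≅⇒ iso)))) , sumAssociates-2a≉0 a+a≉0)
    ... | no a≉0 | yes _ | inj₁ 𝔪a⊆[0] =
      inj₁ (inj₁ (socle⇒𝔽₂-iso a≉0 a-socle) , trans (sumAssociates-socle a-socle) (socle≈e a-socle a≉0))
      where
      a-socle : Socle a
      a-socle r res-r with 𝔪a⊆[0] res-r
      ... | here ra≈0 = ra≈0
    ... | no _ | yes a+a≈0 | inj₂ (t , res-t , ta∉[0]) with 𝔪· a ⊆? 0# ∷ t * a ∷ []
    ...   | inj₁ 𝔪a⊆[0,ta] =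
      inj₁ (inj₂ quotientIso-𝔽₂[x]/x² , trans sumAssociates≈x (socle≈e x-socle (ta∉[0] ∘ here)))
      where open 𝔪a-TwoElements a+a≈0 res-t (ta∉[0] ∘ here) 𝔪a⊆[0,ta]
    ...   | inj₂ (t′ , res-t′ , t′a∉[0,ta]) =
      inj₂ ((λ iso → t′a≉ta (proj₂ (proj₂ (R/Ann≅⇒ iso)) res-t′ res-t t′a≉0 ta≉0))
           , sumAssociates-𝔪a≥3 a+a≈0 res-t res-t′ ta≉0 t′a≉0 (t′a≉ta ∘ sym))
      where
      ta≉0 : ¬ t * a ≈ 0#
      ta≉0 = ta∉[0] ∘ here
      t′a≉0 : ¬ t′ * a ≈ 0#
      t′a≉0 = t′a∉[0,ta] ∘ here
      t′a≉ta : ¬ t′ * a ≈ t * a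
      t′a≉ta = t′a∉[0,ta] ∘ there ∘ here

lemma4p10 : ∀ {c ℓ} (R : CommutativeRing c ℓ) (F : Finite R) →
    IsLocal R → IsFrobenius R → QuotientIso R (NonUnit R) 𝔽₂ →
    (e : CommutativeRing.Carrier R) →
    (∀ x → Ann R e x ⇔ NonUnit R x) →
    (a : CommutativeRing.Carrier R) →
    ((QuotientIso R (Ann R a) 𝔽₂ ⊎ QuotientIso R (Ann R a) 𝔽₂[x]/x²) →
       CommutativeRing._≈_ R (sumAssociates R F a) e)
    × (¬ (QuotientIso R (Ann R a) 𝔽₂ ⊎ QuotientIso R (Ann R a) 𝔽₂[x]/x²) →
       CommutativeRing._≈_ R (sumAssociates R F a) (CommutativeRing.0# R))
lemma4p10 R F _ FR R/𝔪≅𝔽₂ e Ann-e a =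
  [ (λ (iso , sum≈e) → (λ _ → sum≈e) , contradiction iso)
  , (λ (¬iso , sum≈0) → (λ iso → contradiction iso ¬iso) , (λ _ → sum≈0))
  ] (classify a)
  where
  open ResidueField R F R/𝔪≅𝔽₂
  open Frobenius FR e Ann-e
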